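{- Let $\lambda\ge 1$ be an integer and let $(V,B)$ be a balanced incomplete block design with $v=6\lambda-2$ points, $b=9\lambda-3$ blocks, replication number $r=3\lambda$, block size $k=2\lambda$ and index $\lambda$. Then no two blocks of $B$ are identical (i.e., $B$ contains no repeated block).
   Context: A $(v,k,\lambda)$ balanced incomplete block design is a pair $(V,B)$ where $V$ is a $v$-set and $B$ is a collection (multiset) of $b$ $k$-subsets of $V$, called blocks, such that each element of $V$ lies in exactly $r$ blocks and each 2-subset of $V$ lies in exactly $\lambda$ blocks. Two blocks are identical if they are equal as subsets of $V$ (appearing as distinct members of the collection $B$). -}

module Defs where

open import Data.Nat using (ℕ; _+_; _*_; _∸_)
open import Data.Fin using (Fin)
open import Data.Fin.Subset using (Subset; ∣_∣; _∈_)
open import Data.Fin.Subset.Properties using (_∈?_)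
open import Data.Vec using (tabulate)
open import Data.Bool using (Bool; _∧_)
open import Data.Product using (_×_)
open import Relation.Binary.PropositionalEquality using (_≡_)
open import Relation.Nullary using (¬_)
open import Relation.Nullary.Decidable using (⌊_⌋)

-- A collection (multiset) of b blocks on the point set V = Fin v is an
-- indexed family  B : Fin b → Subset v  (repetition allowed: B i may equal B j).
Blocks : ℕ → ℕ → Set
Blocks v b = Fin b → Subset v

countContaining : ∀ {v b} → Blocks v b → Fin v → ℕ
countContaining B x = ∣ tabulate (λ j → ⌊ x ∈? B j ⌋) ∣

countContainingPair : ∀ {v b} → Blocks v b → Fin v → Fin v → ℕ
countContainingPair B x y = ∣ tabulate (λ j → ⌊ x ∈? B j ⌋ ∧ ⌊ y ∈? B j ⌋) ∣

record IsBIBD (v b r k λ′ : ℕ) (B : Blocks v b) : Set where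
  field
    blockSize   : ∀ j → ∣ B j ∣ ≡ k
    replication : ∀ x → countContaining B x ≡ r
    balance     : ∀ x y → ¬ (x ≡ y) → countContainingPair B x y ≡ λ′

{-# OPTIONS --safe #-}
-- Fix a repeated block B i = B i′ and let x j = |B i ∩ B j|. Counting incidences gives
-- ∑ x j = k r and ∑ x j² = λ k² + k (r − λ). Dropping the two terms x i = x i′ = k leaves b − 2
-- numbers, and Cauchy–Schwarz (∑ y)² ≤ (b − 2) ∑ y² for them becomes, at the given parameters,
-- (2λ (3λ − 2))² ≤ (9λ − 5) · 4λ² (λ − 1), which fails by 4λ² (2λ − 1).
module Submission where

open import Defs
open import Data.Nat using (ℕ; zero; suc; _+_; _*_; _∸_; _≥_; _≤_; _<_; s≤s; z≤n)
open import Data.Nat.Properties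
open import Data.Nat.Tactic.RingSolver using (solve-∀)
open import Data.Fin using (Fin; zero; suc; punchIn; punchOut)
open import Data.Fin.Properties using (punchIn-punchOut; punchInᵢ≢i)
open import Data.Fin.Subset using (Subset; ∣_∣; inside; outside)
open import Data.Fin.Subset.Properties using (_∈?_)
open import Data.Vec using (tabulate; _∷_; [])
open import Data.Bool using (Bool; true; false; _∧_)
open import Data.Product using (∃₂; _×_; _,_)
open import Data.Sum using (inj₁; inj₂)
open import Function using (_∘_)
open import Relation.Binary.PropositionalEquality
open import Relation.Nullary using (¬_; yes; no; contradiction)
open import Relation.Nullary.Decidable using (⌊_⌋)
open import Algebra.Properties.Semiring.Sum +-*-semiring
  using (sum; sum-syntax; ∑-distrib-+; ∑-comm; *-distribˡ-sum; *-distribʳ-sum; sum-remove; sum-cong-≗)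
open import Algebra.Properties.CommutativeSemigroup *-commutativeSemigroup
  using (interchange; xy∙z≈y∙xz; x∙yz≈y∙xz)

∑-const : ∀ n c → ∑[ _ < n ] c ≡ n * c
∑-const zero    c = refl
∑-const (suc n) c = cong (c +_) (∑-const n c)

∑-mono-≤ : ∀ {n} {f g : Fin n → ℕ} → (∀ i → f i ≤ g i) → sum f ≤ sum g
∑-mono-≤ {zero}  f≤g = z≤n
∑-mono-≤ {suc n} f≤g = +-mono-≤ (f≤g zero) (∑-mono-≤ (f≤g ∘ suc))

sum*sum : ∀ {m n} (f : Fin m → ℕ) (g : Fin n → ℕ) →
          sum f * sum g ≡ ∑[ p < m ] ∑[ q < n ] (f p * g q)
sum*sum f g = trans (*-distribʳ-sum (sum g) f)
                    (sum-cong-≗ (λ p → *-distribˡ-sum (f p) g))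

sum-except : ∀ {n} {f g : Fin n → ℕ} (p : Fin n) → (∀ q → q ≢ p → f q ≡ g q) →
             sum f + g p ≡ sum g + f p
sum-except {suc n} {f} {g} p f≡g = begin
  sum f + g p                                        ≡⟨ cong (_+ g p) (sum-remove {i = p} f) ⟩
  f p + sum (f ∘ punchIn p) + g p                    ≡⟨ cong (λ s → f p + s + g p) rest ⟩
  f p + sum (g ∘ punchIn p) + g p                    ≡⟨ swap (f p) _ (g p) ⟩
  g p + sum (g ∘ punchIn p) + f p                    ≡⟨ cong (_+ f p) (sum-remove {i = p} g) ⟨
  sum g + f p                                        ∎
  where
  open ≡-Reasoning
  swap : ∀ a s c → a + s + c ≡ c + s + a
  swap = solve-∀
  rest : sum (f ∘ punchIn p) ≡ sum (g ∘ punchIn p)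
  rest = sum-cong-≗ (λ q → f≡g (punchIn p q) (punchInᵢ≢i p q))

sum-remove₂ : ∀ {n} {i j : Fin (suc (suc n))} (i≢j : i ≢ j) (f : Fin (suc (suc n)) → ℕ) →
              sum f ≡ f i + f j + sum (f ∘ punchIn i ∘ punchIn (punchOut i≢j))
sum-remove₂ {i = i} {j} i≢j f = begin
  sum f                                        ≡⟨ sum-remove {i = i} f ⟩
  f i + sum (f ∘ punchIn i)                    ≡⟨ cong (f i +_) (sum-remove {i = j′} (f ∘ punchIn i)) ⟩
  f i + (f (punchIn i j′) + sum rest)          ≡⟨ cong (λ l → f i + (f l + sum rest)) (punchIn-punchOut i≢j) ⟩
  f i + (f j + sum rest)                       ≡⟨ +-assoc (f i) (f j) (sum rest) ⟨
  f i + f j + sum rest                         ∎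
  where
  open ≡-Reasoning
  j′ = punchOut i≢j
  rest = f ∘ punchIn i ∘ punchIn j′

m≤n⇒2*m*n≤m*m+n*n : ∀ {m n} → m ≤ n → 2 * m * n ≤ m * m + n * n
m≤n⇒2*m*n≤m*m+n*n {m} m≤n with o , refl ← m≤n⇒∃[o]m+o≡n m≤n =
  subst (2 * m * (m + o) ≤_) (expand m o) (m≤m+n _ (o * o))
  where
  expand : ∀ m o → 2 * m * (m + o) + o * o ≡ m * m + (m + o) * (m + o)
  expand = solve-∀

2*m*n≤m*m+n*n : ∀ m n → 2 * m * n ≤ m * m + n * n
2*m*n≤m*m+n*n m n with ≤-total m n
... | inj₁ m≤n = m≤n⇒2*m*n≤m*m+n*n m≤n
... | inj₂ n≤m = subst₂ _≤_ (swap n m) (+-comm (n * n) (m * m)) (m≤n⇒2*m*n≤m*m+n*n n≤m)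
  where
  swap : ∀ n m → 2 * n * m ≡ 2 * m * n
  swap = solve-∀

cauchy-schwarz : ∀ {n} (y : Fin n → ℕ) → sum y * sum y ≤ n * ∑[ j < n ] (y j * y j)
cauchy-schwarz {zero}  y = z≤n
cauchy-schwarz {n@(suc _)} y =
  *-cancelˡ-≤ n (+-cancelʳ-≤ (n * (S * S)) (n * (S * S)) (n * (n * Q)) doubled)
  where
  open ≤-Reasoning
  S = sum y
  Q = ∑[ j < n ] (y j * y j)
  linear : ∀ n S y → 2 * (n * y) * S ≡ 2 * n * S * y
  linear = solve-∀
  square : ∀ n S y → n * y * (n * y) + S * S ≡ n * n * (y * y) + S * S
  square = solve-∀
  regroup : ∀ n S Q → n * n * Q + n * (S * S) ≡ n * (n * Q) + n * (S * S)
  regroup = solve-∀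
  double : ∀ n S → 2 * n * S * S ≡ n * (S * S) + n * (S * S)
  double = solve-∀
  doubled : n * (S * S) + n * (S * S) ≤ n * (n * Q) + n * (S * S)
  doubled = begin
    n * (S * S) + n * (S * S)                         ≡⟨ double n S ⟨
    2 * n * S * S                                     ≡⟨ *-distribˡ-sum (2 * n * S) y ⟩
    ∑[ j < n ] (2 * n * S * y j)                      ≡⟨ sum-cong-≗ (λ j → linear n S (y j)) ⟨
    ∑[ j < n ] (2 * (n * y j) * S)                    ≤⟨ ∑-mono-≤ (λ j → 2*m*n≤m*m+n*n (n * y j) S) ⟩
    ∑[ j < n ] (n * y j * (n * y j) + S * S)          ≡⟨ sum-cong-≗ (λ j → square n S (y j)) ⟩
    ∑[ j < n ] (n * n * (y j * y j) + S * S)          ≡⟨ ∑-distrib-+ (λ j → n * n * (y j * y j)) (λ _ → S * S) ⟩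
    ∑[ j < n ] (n * n * (y j * y j)) + ∑[ _ < n ] (S * S)
                                                      ≡⟨ cong₂ _+_ (*-distribˡ-sum (n * n) (λ j → y j * y j)) (sym (∑-const n (S * S))) ⟨
    n * n * Q + n * (S * S)                           ≡⟨ regroup n S Q ⟩
    n * (n * Q) + n * (S * S)                         ∎

χ : Bool → ℕ
χ true  = 1
χ false = 0

χ-∧ : ∀ a b → χ (a ∧ b) ≡ χ a * χ b
χ-∧ true  true  = refl
χ-∧ true  false = refl
χ-∧ false _     = refl

χ-idem : ∀ a → χ a * χ a ≡ χ a
χ-idem true  = refl
χ-idem false = refl

∣tabulate∣≡∑χ : ∀ {n} (f : Fin n → Bool) → ∣ tabulate f ∣ ≡ ∑[ i < n ] χ (f i)
∣tabulate∣≡∑χ {zero}  f = refl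
∣tabulate∣≡∑χ {suc n} f with f zero
... | true  = cong suc (∣tabulate∣≡∑χ (f ∘ suc))
... | false = ∣tabulate∣≡∑χ (f ∘ suc)

⌊suc∈?∷⌋ : ∀ {n} (p : Fin n) x s → ⌊ suc p ∈? x ∷ s ⌋ ≡ ⌊ p ∈? s ⌋
⌊suc∈?∷⌋ p x s with p ∈? s
... | yes _ = refl
... | no  _ = refl

∣s∣≡∑χ∈ : ∀ {n} (s : Subset n) → ∣ s ∣ ≡ ∑[ p < n ] χ ⌊ p ∈? s ⌋
∣s∣≡∑χ∈ []            = refl
∣s∣≡∑χ∈ (inside  ∷ s) =
  cong suc (trans (∣s∣≡∑χ∈ s) (sum-cong-≗ (λ p → cong χ (sym (⌊suc∈?∷⌋ p inside s)))))
∣s∣≡∑χ∈ (outside ∷ s) =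
  trans (∣s∣≡∑χ∈ s) (sum-cong-≗ (λ p → cong χ (sym (⌊suc∈?∷⌋ p outside s))))

module Intersections {v b r k λ′} {B : Blocks v b} (design : IsBIBD v b r k λ′ B) where
  open IsBIBD design
  open ≡-Reasoning

  incidence : Fin v → Fin b → ℕ
  incidence p j = χ ⌊ p ∈? B j ⌋

  incidence-idem : ∀ p j → incidence p j * incidence p j ≡ incidence p j
  incidence-idem p j = χ-idem ⌊ p ∈? B j ⌋

  ∑-incidence-point : ∀ p → ∑[ j < b ] incidence p j ≡ r
  ∑-incidence-point p = trans (sym (∣tabulate∣≡∑χ (λ j → ⌊ p ∈? B j ⌋))) (replication p)

  ∑-incidence-block : ∀ j → ∑[ p < v ] incidence p j ≡ k
  ∑-incidence-block j = trans (sym (∣s∣≡∑χ∈ (B j))) (blockSize j)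

  ∑-incidence-block* : ∀ j c → ∑[ p < v ] (incidence p j * c) ≡ k * c
  ∑-incidence-block* j c =
    trans (sym (*-distribʳ-sum c (λ p → incidence p j))) (cong (_* c) (∑-incidence-block j))

  concurrence : Fin v → Fin v → ℕ
  concurrence p q = ∑[ j < b ] (incidence p j * incidence q j)

  concurrence-distinct : ∀ p q → p ≢ q → concurrence p q ≡ λ′
  concurrence-distinct p q p≢q = begin
    concurrence p q                ≡⟨ sum-cong-≗ (λ j → χ-∧ ⌊ p ∈? B j ⌋ ⌊ q ∈? B j ⌋) ⟨
    ∑[ j < b ] χ (⌊ p ∈? B j ⌋ ∧ ⌊ q ∈? B j ⌋)
                                   ≡⟨ ∣tabulate∣≡∑χ (λ j → ⌊ p ∈? B j ⌋ ∧ ⌊ q ∈? B j ⌋) ⟨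
    countContainingPair B p q      ≡⟨ balance p q p≢q ⟩
    λ′                             ∎

  concurrence-self : ∀ p → concurrence p p ≡ r
  concurrence-self p = trans (sum-cong-≗ (incidence-idem p)) (∑-incidence-point p)

  intersection : Fin b → Fin b → ℕ
  intersection i j = ∑[ p < v ] (incidence p i * incidence p j)

  intersection-self : ∀ i → intersection i i ≡ k
  intersection-self i = trans (sum-cong-≗ (λ p → incidence-idem p i)) (∑-incidence-block i)

  intersection-repeated : ∀ {i i′} → B i ≡ B i′ → intersection i i′ ≡ k
  intersection-repeated {i} Bi≡Bi′ =
    trans (sum-cong-≗ (λ p → cong (λ s → incidence p i * χ ⌊ p ∈? s ⌋) (sym Bi≡Bi′)))
          (intersection-self i)

  ∑-intersection : ∀ i → ∑[ j < b ] intersection i j ≡ k * r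
  ∑-intersection i = begin
    ∑[ j < b ] ∑[ p < v ] (incidence p i * incidence p j)  ≡⟨ ∑-comm (λ j p → incidence p i * incidence p j) ⟩
    ∑[ p < v ] ∑[ j < b ] (incidence p i * incidence p j)  ≡⟨ sum-cong-≗ (λ p → *-distribˡ-sum (incidence p i) (incidence p)) ⟨
    ∑[ p < v ] (incidence p i * ∑[ j < b ] incidence p j)  ≡⟨ sum-cong-≗ (λ p → cong (incidence p i *_) (∑-incidence-point p)) ⟩
    ∑[ p < v ] (incidence p i * r)                        ≡⟨ ∑-incidence-block* i r ⟩
    k * r                                                 ∎

  ∑-intersection²≡∑∑concurrence : ∀ i →
    ∑[ j < b ] (intersection i j * intersection i j) ≡
    ∑[ p < v ] ∑[ q < v ] (incidence p i * incidence q i * concurrence p q)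
  ∑-intersection²≡∑∑concurrence i = begin
    ∑[ j < b ] (intersection i j * intersection i j)
      ≡⟨ sum-cong-≗ (λ j → sum*sum (λ p → a p * incidence p j) (λ q → a q * incidence q j)) ⟩
    ∑[ j < b ] ∑[ p < v ] ∑[ q < v ] (a p * incidence p j * (a q * incidence q j))
      ≡⟨ ∑-comm (λ j p → ∑[ q < v ] (a p * incidence p j * (a q * incidence q j))) ⟩
    ∑[ p < v ] ∑[ j < b ] ∑[ q < v ] (a p * incidence p j * (a q * incidence q j))
      ≡⟨ sum-cong-≗ (λ p → ∑-comm (λ j q → a p * incidence p j * (a q * incidence q j))) ⟩
    ∑[ p < v ] ∑[ q < v ] ∑[ j < b ] (a p * incidence p j * (a q * incidence q j))
      ≡⟨ sum-cong-≗ (λ p → sum-cong-≗ (λ q → pull-out p q)) ⟩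
    ∑[ p < v ] ∑[ q < v ] (a p * a q * concurrence p q) ∎
    where
    a : Fin v → ℕ
    a p = incidence p i
    pull-out : ∀ p q → ∑[ j < b ] (a p * incidence p j * (a q * incidence q j)) ≡ a p * a q * concurrence p q
    pull-out p q = trans (sum-cong-≗ (λ j → interchange (a p) (incidence p j) (a q) (incidence q j)))
                         (sym (*-distribˡ-sum (a p * a q) (λ j → incidence p j * incidence q j)))

  ∑-concurrence-row : ∀ i p →
    ∑[ q < v ] (incidence p i * incidence q i * concurrence p q) + incidence p i * λ′ ≡
    incidence p i * (k * λ′) + incidence p i * r
  ∑-concurrence-row i p = begin
    ∑[ q < v ] f q + a p * λ′       ≡⟨ cong (λ x → ∑[ q < v ] f q + x * λ′) (incidence-idem p i) ⟨
    ∑[ q < v ] f q + g p            ≡⟨ sum-except p off-diagonal ⟩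
    ∑[ q < v ] g q + f p            ≡⟨ cong₂ _+_ ∑g diagonal ⟩
    a p * (k * λ′) + a p * r        ∎
    where
    a : Fin v → ℕ
    a q = incidence q i
    f g : Fin v → ℕ
    f q = a p * a q * concurrence p q
    g q = a p * a q * λ′
    off-diagonal : ∀ q → q ≢ p → f q ≡ g q
    off-diagonal q q≢p = cong (a p * a q *_) (concurrence-distinct p q (q≢p ∘ sym))
    diagonal : f p ≡ a p * r
    diagonal = cong₂ _*_ (incidence-idem p i) (concurrence-self p)
    ∑g : ∑[ q < v ] g q ≡ a p * (k * λ′)
    ∑g = begin
      ∑[ q < v ] g q                ≡⟨ sum-cong-≗ (λ q → xy∙z≈y∙xz (a p) (a q) λ′) ⟩
      ∑[ q < v ] (a q * (a p * λ′)) ≡⟨ ∑-incidence-block* i (a p * λ′) ⟩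
      k * (a p * λ′)                ≡⟨ x∙yz≈y∙xz k (a p) λ′ ⟩
      a p * (k * λ′)                ∎

  ∑-intersection² : ∀ i →
    ∑[ j < b ] (intersection i j * intersection i j) + k * λ′ ≡ k * k * λ′ + k * r
  ∑-intersection² i = begin
    ∑[ j < b ] (intersection i j * intersection i j) + k * λ′
      ≡⟨ cong₂ _+_ (∑-intersection²≡∑∑concurrence i) (sym (∑-incidence-block* i λ′)) ⟩
    ∑[ p < v ] row p + ∑[ p < v ] (a p * λ′)  ≡⟨ ∑-distrib-+ row (λ p → a p * λ′) ⟨
    ∑[ p < v ] (row p + a p * λ′)             ≡⟨ sum-cong-≗ (∑-concurrence-row i) ⟩
    ∑[ p < v ] (a p * (k * λ′) + a p * r)     ≡⟨ ∑-distrib-+ (λ p → a p * (k * λ′)) (λ p → a p * r) ⟩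
    ∑[ p < v ] (a p * (k * λ′)) + ∑[ p < v ] (a p * r)
      ≡⟨ cong₂ _+_ (∑-incidence-block* i (k * λ′)) (∑-incidence-block* i r) ⟩
    k * (k * λ′) + k * r                      ≡⟨ cong (_+ k * r) (*-assoc k k λ′) ⟨
    k * k * λ′ + k * r                        ∎
    where
    a : Fin v → ℕ
    a p = incidence p i
    row : Fin v → ℕ
    row p = ∑[ q < v ] (a p * a q * concurrence p q)

-- s and q are the sum and the sum of squares of the other b − 2 intersection numbers with B i:
-- the two equations say s = k r − 2k and q = λ k² + k (r − λ) − 2k² without truncated subtraction.
repeated-block-bound :
  ∀ {v b r k λ′} {B : Blocks v b} → IsBIBD v b r k λ′ B →
  ∀ {i i′} → i ≢ i′ → B i ≡ B i′ →
  ∃₂ λ s q → s + 2 * k ≡ k * r × q + 2 * (k * k) + k * λ′ ≡ k * k * λ′ + k * r × s * s ≤ (b ∸ 2) * q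
repeated-block-bound {b = suc zero} _ {zero} {zero} 0≢0 _ = contradiction refl 0≢0
repeated-block-bound {b = suc (suc n)} {r} {k} {λ′} design {i} {i′} i≢i′ Bi≡Bi′ =
  sum y , ∑[ j < n ] (y j * y j) , linear , quadratic , cauchy-schwarz y
  where
  open Intersections design
  open ≡-Reasoning
  x : Fin (suc (suc n)) → ℕ
  x = intersection i
  y : Fin n → ℕ
  y = x ∘ punchIn i ∘ punchIn (punchOut i≢i′)
  xi≡k : x i ≡ k
  xi≡k = intersection-self i
  xi′≡k : x i′ ≡ k
  xi′≡k = intersection-repeated Bi≡Bi′
  peel : ∀ s c → s + 2 * c ≡ c + c + s
  peel = solve-∀
  linear : sum y + 2 * k ≡ k * r
  linear = begin
    sum y + 2 * k        ≡⟨ peel (sum y) k ⟩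
    k + k + sum y        ≡⟨ cong₂ (λ a c → a + c + sum y) xi≡k xi′≡k ⟨
    x i + x i′ + sum y   ≡⟨ sum-remove₂ i≢i′ x ⟨
    sum x                ≡⟨ ∑-intersection i ⟩
    k * r                ∎
  quadratic : ∑[ j < n ] (y j * y j) + 2 * (k * k) + k * λ′ ≡ k * k * λ′ + k * r
  quadratic = begin
    Q + 2 * (k * k) + k * λ′                ≡⟨ cong (_+ k * λ′) (peel Q (k * k)) ⟩
    k * k + k * k + Q + k * λ′              ≡⟨ cong₂ (λ a c → a * a + c * c + Q + k * λ′) xi≡k xi′≡k ⟨
    x i * x i + x i′ * x i′ + Q + k * λ′    ≡⟨ cong (_+ k * λ′) (sum-remove₂ i≢i′ (λ j → x j * x j)) ⟨
    ∑[ j < suc (suc n) ] (x j * x j) + k * λ′ ≡⟨ ∑-intersection² i ⟩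
    k * k * λ′ + k * r                      ∎
    where
    Q = ∑[ j < n ] (y j * y j)

repeated-block-bound-fails : ∀ m s q →
  s + 2 * (2 * suc m) ≡ 2 * suc m * (3 * suc m) →
  q + 2 * (2 * suc m * (2 * suc m)) + 2 * suc m * suc m ≡
    2 * suc m * (2 * suc m) * suc m + 2 * suc m * (3 * suc m) →
  ¬ s * s ≤ (9 * suc m ∸ 3 ∸ 2) * q
repeated-block-bound-fails m s q linear quadratic s²≤[b-2]q =
  <⇒≱ [b-2]q<s² s²≤[b-2]q
  where
  open ≡-Reasoning
  l = suc m
  s≡ : s ≡ 2 * l * (3 * m + 1)
  s≡ = +-cancelʳ-≡ (2 * (2 * l)) s _ (trans linear (expand m))
    where
    expand : ∀ m → 2 * suc m * (3 * suc m) ≡ 2 * suc m * (3 * m + 1) + 2 * (2 * suc m)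
    expand = solve-∀
  q≡ : q ≡ 4 * (l * l) * m
  q≡ = +-cancelʳ-≡ _ q _ (trans (sym (+-assoc q _ _)) (trans quadratic (expand m)))
    where
    expand : ∀ m → 2 * suc m * (2 * suc m) * suc m + 2 * suc m * (3 * suc m) ≡
                   4 * (suc m * suc m) * m + (2 * (2 * suc m * (2 * suc m)) + 2 * suc m * suc m)
    expand = solve-∀
  b-2≡ : 9 * l ∸ 3 ∸ 2 ≡ 9 * m + 4
  b-2≡ = begin
    9 * l ∸ 3 ∸ 2      ≡⟨ ∸-+-assoc (9 * l) 3 2 ⟩
    9 * l ∸ 5          ≡⟨ cong (_∸ 5) (expand m) ⟩
    9 * m + 4 + 5 ∸ 5  ≡⟨ m+n∸n≡m (9 * m + 4) 5 ⟩
    9 * m + 4          ∎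
    where
    expand : ∀ m → 9 * suc m ≡ 9 * m + 4 + 5
    expand = solve-∀
  [b-2]q : (9 * l ∸ 3 ∸ 2) * q ≡ (9 * m + 4) * (4 * (l * l) * m)
  [b-2]q = cong₂ _*_ b-2≡ q≡
  s² : (9 * m + 4) * (4 * (l * l) * m) + suc (2 * m) * (4 * (l * l)) ≡ s * s
  s² = trans (gap m) (sym (cong₂ _*_ s≡ s≡))
    where
    gap : ∀ m → (9 * m + 4) * (4 * (suc m * suc m) * m) + suc (2 * m) * (4 * (suc m * suc m)) ≡
                2 * suc m * (3 * m + 1) * (2 * suc m * (3 * m + 1))
    gap = solve-∀
  [b-2]q<s² : (9 * l ∸ 3 ∸ 2) * q < s * s
  [b-2]q<s² = subst₂ _<_ (sym [b-2]q) s² (m<m+n _ (s≤s z≤n))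

corollary1 : (λ′ : ℕ) → λ′ ≥ 1 → (B : Blocks (6 * λ′ ∸ 2) (9 * λ′ ∸ 3)) →
    IsBIBD (6 * λ′ ∸ 2) (9 * λ′ ∸ 3) (3 * λ′) (2 * λ′) λ′ B →
    (i j : Fin (9 * λ′ ∸ 3)) → ¬ (i ≡ j) → ¬ (B i ≡ B j)
corollary1 (suc m) _ B design i j i≢j Bi≡Bj
  with s , q , linear , quadratic , s²≤[b-2]q ← repeated-block-bound design i≢j Bi≡Bj =
  repeated-block-bound-fails m s q linear quadratic s²≤[b-2]q
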